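{- Fix integers $k\ge1$ and $\ell\ge\max\{4,k^2\}$. For every integer $h\ge0$, the tree $T_{h,\ell}$ (defined in the context) has pathwidth exactly $h$.
   Context: Recursive construction: $T_{0,\ell}$ is a single vertex $r_0$. For $h\ge1$, $T_{h,\ell}$ consists of a path $P_h=(p^h_1,\dots,p^h_\ell)$ on $\ell$ vertices together with, for each $i\in\{1,\dots,\ell\}$, a disjoint copy of $T_{h-1,\ell}$ whose root is joined by an edge to $p^h_i$; the root of $T_{h,\ell}$ is $r_h:=p^h_1$. Pathwidth: a path decomposition of a graph $G$ is a sequence of vertex sets $B_1,\dots,B_m$ covering $V(G)$ such that every edge lies inside some $B_i$ and for each vertex $v$ the set $\{i:v\in B_i\}$ is an interval; the pathwidth is the minimum over decompositions of $\max_i|B_i|-1$. -}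

module Defs where

open import Data.Nat using (ℕ; zero; suc; _≤_)
open import Data.Fin as Fin using (Fin; toℕ)
open import Data.Unit using (⊤; tt)
open import Data.Empty using (⊥)
open import Data.Sum using (_⊎_; inj₁; inj₂)
open import Data.Product using (Σ; _×_; _,_; ∃)
open import Data.List using (List; length)
open import Data.List.Membership.Propositional using (_∈_)
open import Data.List.Relation.Unary.Unique.Propositional using (Unique)
open import Relation.Binary.PropositionalEquality using (_≡_)

-- A (simple, undirected) graph is given by a vertex type V and an edge
-- relation E; orientation of E is irrelevant for path decompositions.
-- A path decomposition is a sequence B_0,...,B_{m-1} of bags (duplicate-free
-- lists of vertices, so |B_i| = length) covering V, such that every edge lies
-- in some bag and the bags containing any vertex form an interval.
record PathDecomposition (V : Set) (E : V → V → Set) : Set₁ where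
  field
    m        : ℕ
    bag      : Fin m → List V
    unique   : ∀ i → Unique (bag i)
    cover    : ∀ v → ∃ λ i → v ∈ bag i
    edge     : ∀ u v → E u v → ∃ λ i → (u ∈ bag i) × (v ∈ bag i)
    interval : ∀ v (i j k : Fin m) → i Fin.≤ j → j Fin.≤ k →
               v ∈ bag i → v ∈ bag k → v ∈ bag j

open PathDecomposition public

-- width(D) = max_i |B_i| - 1 is at most p
WidthAtMost : ∀ {V E} → PathDecomposition V E → ℕ → Set
WidthAtMost D p = ∀ i → length (bag D i) ≤ suc p

WidthAtLeast : ∀ {V E} → PathDecomposition V E → ℕ → Set
WidthAtLeast D p = ∃ λ i → suc p ≤ length (bag D i)

PathwidthIs : (V : Set) (E : V → V → Set) → ℕ → Set₁
PathwidthIs V E p =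
  (Σ (PathDecomposition V E) λ D → WidthAtMost D p) ×
  (∀ (D : PathDecomposition V E) → WidthAtLeast D p)

-- Vertices of T_{h+1,ℓ}: path vertices p_i (inj₁ i, i : Fin ℓ; Fin index i
-- corresponds to p_{i+1}) and, for each i, the vertices of the i-th copy of
-- T_{h,ℓ} (inj₂ (i , v)).
TVert : ℕ → ℕ → Set
TVert zero    ℓ = ⊤
TVert (suc h) ℓ = Fin ℓ ⊎ (Fin ℓ × TVert h ℓ)

-- The root: r_0 for h = 0, and r_h = p^h_1 (index 0) for h ≥ 1.
IsRoot : (h ℓ : ℕ) → TVert h ℓ → Set
IsRoot zero    ℓ v        = ⊤
IsRoot (suc h) ℓ (inj₁ i) = toℕ i ≡ 0
IsRoot (suc h) ℓ (inj₂ _) = ⊥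

data TEdge (ℓ : ℕ) : (h : ℕ) → TVert h ℓ → TVert h ℓ → Set where
  path   : ∀ {h} (i j : Fin ℓ) → suc (toℕ i) ≡ toℕ j →
           TEdge ℓ (suc h) (inj₁ i) (inj₁ j)
  hang   : ∀ {h} (i : Fin ℓ) (v : TVert h ℓ) → IsRoot h ℓ v →
           TEdge ℓ (suc h) (inj₁ i) (inj₂ (i , v))
  inside : ∀ {h} (i : Fin ℓ) (u v : TVert h ℓ) → TEdge ℓ h u v →
           TEdge ℓ (suc h) (inj₂ (i , u)) (inj₂ (i , v))

{-# OPTIONS --safe #-}
module Submission where

-- Upper bound: from a decomposition of T_h with n bags, one of T_(h+1) with ℓ (n + 1) bags is
-- obtained by walking along the path: for each p_i, first the bag {p_(i-1), p_i}, then the bags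
-- for the i-th copy of T_h, each extended by p_i.  The width grows by one.
--
-- Lower bound (ℓ ≥ 3 suffices): the bags containing a vertex form an interval of positions,
-- and intervals of adjacent vertices overlap.  By induction, in each of three copies of T_h
-- some position lies in the intervals of h + 1 distinct vertices of that copy.  Let copy c
-- have the middle such position, between those of copies a and b.  The walk from copy a to
-- copy b through the path avoids copy c, so one of its vertices also lies at that position,
-- which gives h + 2 distinct vertices in one bag.

open import Defs
open import Data.Nat as ℕ using (ℕ; zero; suc; _+_; _*_; _≤_; _<_; z≤n; s≤s; NonZero)
import Data.Nat.Properties as ℕ
open import Data.Fin as Fin using (Fin; zero; suc; toℕ; inject₁; combine; remQuot; _↑ˡ_; #_)
import Data.Fin.Properties as Fin
open import Data.Unit using (⊤; tt)
open import Data.Sum using (_⊎_; inj₁; inj₂)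
open import Data.Sum.Properties using (inj₂-injective)
open import Data.Product using (Σ; _×_; _,_; ∃; ∃₂; proj₁; proj₂; uncurry; map₂; swap)
open import Data.Product.Properties using (,-injectiveʳ)
open import Data.List using (List; []; _∷_; length; map)
open import Data.List.Properties using (length-map)
open import Data.List.Membership.Propositional using (_∈_)
open import Data.List.Membership.Propositional.Properties using (∈-map⁺; ∈-map⁻)
open import Data.List.Membership.Setoid.Properties using (index-injective)
open import Data.List.Relation.Unary.Any using (here; there)
open import Data.List.Relation.Unary.All using ([]; universal)
import Data.List.Relation.Unary.All.Properties as All
open import Data.List.Relation.Unary.AllPairs using ([]; _∷_)
open import Data.List.Relation.Unary.Unique.Propositional using (Unique)
import Data.List.Relation.Unary.Unique.Propositional.Properties as Unique
open import Level using (0ℓ)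
open import Function using (_∘_; _on_; Injective)
open import Relation.Binary.Core using (Rel; _=[_]⇒_)
open import Relation.Binary.Definitions using (Symmetric)
open import Relation.Binary.PropositionalEquality
  using (_≡_; _≢_; refl; sym; trans; cong; subst; subst₂; setoid)
open import Relation.Binary.Construct.Closure.Symmetric as SymClosure using (SymClosure; fwd; bwd)
open import Relation.Binary.Construct.Closure.ReflexiveTransitive as Star using (Star; ε; _◅_; _◅◅_)
open import Relation.Nullary using (contradiction)

module _ (n : ℕ) .{{_ : NonZero n}} {c q r : ℕ} (r<n : r < n) where

  n*q+r<n*[1+q] : n * q + r < n * suc q
  n*q+r<n*[1+q] = ℕ.<-≤-trans (ℕ.+-monoʳ-< (n * q) r<n)
                    (ℕ.≤-reflexive (trans (ℕ.+-comm (n * q) n) (sym (ℕ.*-suc n q))))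

  lower⇒c≤q : n * c ≤ n * q + r → c ≤ q
  lower⇒c≤q lower = ℕ.s≤s⁻¹ (ℕ.*-cancelˡ-< n c (suc q) (ℕ.≤-<-trans lower n*q+r<n*[1+q]))

  upper⇒q≤1+c : n * q + r ≤ n * suc c → q ≤ suc c
  upper⇒q≤1+c upper = ℕ.*-cancelˡ-≤ n (ℕ.≤-trans (ℕ.m≤m+n (n * q) r) upper)

  between-multiples⇒quotient : n * c ≤ n * q + r → n * q + r ≤ n * suc c →
                               q ≡ c ⊎ (q ≡ suc c × r ≡ 0)
  between-multiples⇒quotient lower upper with ℕ.m≤n⇒m<n∨m≡n (upper⇒q≤1+c upper)
  ... | inj₁ (s≤s q≤c) = inj₁ (ℕ.≤-antisym q≤c (lower⇒c≤q lower))
  ... | inj₂ refl = inj₂ (refl , ℕ.n≤0⇒n≡0 (ℕ.+-cancelˡ-≤ (n * q) r 0 n*q+r≤n*q+0))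
    where
    n*q+r≤n*q+0 : n * q + r ≤ n * q + 0
    n*q+r≤n*q+0 = ℕ.≤-trans upper (ℕ.≤-reflexive (sym (ℕ.+-identityʳ _)))

  quotient⇒between-multiples : q ≡ c ⊎ (q ≡ suc c × r ≡ 0) →
                               n * c ≤ n * q + r × n * q + r ≤ n * suc c
  quotient⇒between-multiples (inj₁ refl) = ℕ.m≤m+n (n * q) r , ℕ.<⇒≤ n*q+r<n*[1+q]
  quotient⇒between-multiples (inj₂ (refl , refl)) =
    ℕ.≤-trans (ℕ.*-monoʳ-≤ n (ℕ.n≤1+n c)) (ℕ.m≤m+n _ 0) , ℕ.≤-reflexive (ℕ.+-identityʳ _)

module _ {m n : ℕ} where

  combine-cancelˡ-≤ : ∀ (i j : Fin m) (k l : Fin n) → combine i k Fin.≤ combine j l → i Fin.≤ j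
  combine-cancelˡ-≤ i j k l ik≤jl = ℕ.≮⇒≥ λ j<i → ℕ.<⇒≱ (Fin.combine-monoˡ-< l k j<i) ik≤jl

  combine-cancelʳ-≤ : ∀ (i : Fin m) (k l : Fin n) → combine i k Fin.≤ combine i l → k Fin.≤ l
  combine-cancelʳ-≤ i k l ik≤il =
    ℕ.+-cancelˡ-≤ (n * toℕ i) _ _ (subst₂ _≤_ (Fin.toℕ-combine i k) (Fin.toℕ-combine i l) ik≤il)

  combine-sandwich : ∀ {i : Fin m} {k l : Fin n} (j : Fin (m * n)) →
                     combine i k Fin.≤ j → j Fin.≤ combine i l →
                     ∃ λ t → j ≡ combine i t × k Fin.≤ t × t Fin.≤ l
  combine-sandwich {i} {k} {l} j ik≤j j≤il with Fin.combine-surjective {m} {n} j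
  ... | i′ , t , refl
    with Fin.≤-antisym (combine-cancelˡ-≤ i′ i t l j≤il) (combine-cancelˡ-≤ i i′ k t ik≤j)
  ...   | refl = t , refl , combine-cancelʳ-≤ i k t ik≤j , combine-cancelʳ-≤ i t l j≤il

median-of-three : ∀ {m} (f : Fin 3 → Fin m) →
                  ∃₂ λ a b → ∃ λ c → a ≢ c × b ≢ c × f a Fin.≤ f c × f c Fin.≤ f b
median-of-three f
  with Fin.≤-total (f (# 0)) (f (# 1)) | Fin.≤-total (f (# 1)) (f (# 2)) | Fin.≤-total (f (# 0)) (f (# 2))
... | inj₁ 0≤1 | inj₁ 1≤2 | _        = # 0 , # 2 , # 1 , (λ ()) , (λ ()) , 0≤1 , 1≤2
... | inj₁ 0≤1 | inj₂ 2≤1 | inj₁ 0≤2 = # 0 , # 1 , # 2 , (λ ()) , (λ ()) , 0≤2 , 2≤1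
... | inj₁ 0≤1 | inj₂ 2≤1 | inj₂ 2≤0 = # 2 , # 1 , # 0 , (λ ()) , (λ ()) , 2≤0 , 0≤1
... | inj₂ 1≤0 | inj₁ 1≤2 | inj₁ 0≤2 = # 1 , # 2 , # 0 , (λ ()) , (λ ()) , 1≤0 , 0≤2
... | inj₂ 1≤0 | inj₁ 1≤2 | inj₂ 2≤0 = # 1 , # 0 , # 2 , (λ ()) , (λ ()) , 1≤2 , 2≤0
... | inj₂ 1≤0 | inj₂ 2≤1 | _        = # 2 , # 0 , # 1 , (λ ()) , (λ ()) , 2≤1 , 1≤0

injective⇒≤-length : ∀ {A : Set} {n} {xs : List A} (f : Fin n → A) →
                     Injective _≡_ _≡_ f → (∀ t → f t ∈ xs) → n ≤ length xs
injective⇒≤-length f f-injective f∈xs =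
  Fin.injective⇒≤ λ same-index → f-injective (index-injective (setoid _) (f∈xs _) (f∈xs _) same-index)

Walk : ∀ {V : Set} → Rel V 0ℓ → Rel V 0ℓ
Walk E = Star (SymClosure E)

module _ {V W : Set} {E : Rel V 0ℓ} {F : Rel W 0ℓ} where

  mapWalk : (f : V → W) → E =[ f ]⇒ F → Walk E =[ f ]⇒ Walk F
  mapWalk f hom = Star.gmap f (SymClosure.gmap f hom)

reverseWalk : ∀ {V : Set} {E : Rel V 0ℓ} → Symmetric (Walk E)
reverseWalk {E = E} = Star.reverse (SymClosure.symmetric E)

-- What the lower bound needs of a path decomposition; unlike bags, it restricts to subgraphs (comap).
record IntervalModel (V : Set) (E : Rel V 0ℓ) (m : ℕ) : Set₁ where
  field
    interval     : V → Fin m → Set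
    inhabited    : ∀ v → ∃ (interval v)
    convex       : ∀ v {i j k} → i Fin.≤ j → j Fin.≤ k → interval v i → interval v k → interval v j
    edge-overlap : ∀ {u v} → E u v → ∃ λ i → interval u i × interval v i

open IntervalModel

intervalModel : ∀ {V E} (D : PathDecomposition V E) → IntervalModel V E (m D)
intervalModel D = record
  { interval     = λ v i → v ∈ bag D i
  ; inhabited    = cover D
  ; convex       = λ v {i} {j} {k} → PathDecomposition.interval D v i j k
  ; edge-overlap = edge D _ _
  }

comap : ∀ {V W E F m} (f : W → V) → F =[ f ]⇒ E → IntervalModel V E m → IntervalModel W F m
comap f hom M = record
  { interval     = interval M ∘ f
  ; inhabited    = inhabited M ∘ f
  ; convex       = convex M ∘ f
  ; edge-overlap = edge-overlap M ∘ hom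
  }

module _ {V E m} (M : IntervalModel V E m) where

  overlap-sym : ∀ {u v} → SymClosure E u v → ∃ λ i → interval M u i × interval M v i
  overlap-sym (fwd e) = edge-overlap M e
  overlap-sym (bwd e) = map₂ swap (edge-overlap M e)

  walk-meets-between : ∀ {u w i j k} → Walk E u w → interval M u i → interval M w k →
                       i Fin.≤ j → j Fin.≤ k → ∃ λ z → interval M z j
  walk-meets-between {u} ε u∈i u∈k i≤j j≤k = u , convex M u i≤j j≤k u∈i u∈k
  walk-meets-between {u} {j = j} (e ◅ walk) u∈i w∈k i≤j j≤k with overlap-sym e
  ... | c , u∈c , v∈c with Fin.≤-total j c
  ...   | inj₁ j≤c = u , convex M u i≤j j≤c u∈i u∈c
  ...   | inj₂ c≤j = walk-meets-between walk v∈c w∈k c≤j j≤k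

record Stab {V E m} (M : IntervalModel V E m) (n : ℕ) : Set where
  field
    point            : Fin m
    vertex           : Fin n → V
    vertex-injective : Injective _≡_ _≡_ vertex
    point∈interval   : ∀ t → interval M (vertex t) point

stab⇒width : ∀ {V E w} (D : PathDecomposition V E) → Stab (intervalModel D) (suc w) → WidthAtLeast D w
stab⇒width D s = point , injective⇒≤-length vertex vertex-injective point∈interval
  where open Stab s

decomposition₀ : ∀ {ℓ} → PathDecomposition (TVert 0 ℓ) (TEdge ℓ 0)
decomposition₀ = record
  { m        = 1
  ; bag      = λ _ → tt ∷ []
  ; unique   = λ _ → [] ∷ []
  ; cover    = λ _ → zero , here refl
  ; edge     = λ _ _ ()
  ; interval = λ _ _ _ _ _ _ _ _ → here refl
  }

module Extension {ℓ h} (D : PathDecomposition (TVert h ℓ) (TEdge ℓ h)) where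

  n : ℕ
  n = suc (m D)

  previous : Fin ℓ → List (TVert (suc h) ℓ)
  previous zero    = []
  previous (suc i) = inj₁ (inject₁ i) ∷ []

  -- Bag combine i k is bag k of block i, so the path vertex inj₁ c occupies exactly the
  -- positions n * c, ..., n * (c + 1): its own block and the first bag of the next one.
  block : Fin ℓ → Fin n → List (TVert (suc h) ℓ)
  block i zero    = inj₁ i ∷ previous i
  block i (suc k) = inj₁ i ∷ map (λ x → inj₂ (i , x)) (bag D k)

  bags : Fin (ℓ * n) → List (TVert (suc h) ℓ)
  bags j = uncurry block (remQuot {ℓ} n j)

  bags-combine : ∀ i k → bags (combine i k) ≡ block i k
  bags-combine i k = cong (uncurry block) (Fin.remQuot-combine i k)

  ∈-bags⁺ : ∀ {v i k} → v ∈ block i k → v ∈ bags (combine i k)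
  ∈-bags⁺ {v} {i} {k} = subst (v ∈_) (sym (bags-combine i k))

  ∈-bags⁻ : ∀ {v i k} → v ∈ bags (combine i k) → v ∈ block i k
  ∈-bags⁻ {v} {i} {k} = subst (v ∈_) (bags-combine i k)

  ∈-previous⁺ : ∀ {c d} → suc (toℕ c) ≡ toℕ d → inj₁ c ∈ previous d
  ∈-previous⁺ {d = zero}  ()
  ∈-previous⁺ {d = suc d} 1+c≡1+d =
    here (cong inj₁ (Fin.toℕ-injective (trans (ℕ.suc-injective 1+c≡1+d) (sym (Fin.toℕ-inject₁ d)))))

  ∈-previous⁻ : ∀ {c d} → inj₁ c ∈ previous d → suc (toℕ c) ≡ toℕ d
  ∈-previous⁻ {d = suc d} (here refl) = cong suc (Fin.toℕ-inject₁ d)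

  copy∈block : ∀ {i k x} → x ∈ bag D k → inj₂ (i , x) ∈ block i (suc k)
  copy∈block = there ∘ ∈-map⁺ _

  inj₁∈block⁺ : ∀ {c i k} → toℕ i ≡ toℕ c ⊎ (toℕ i ≡ suc (toℕ c) × toℕ k ≡ 0) →
                inj₁ c ∈ block i k
  inj₁∈block⁺ {k = zero}  (inj₁ i≡c)         = here (cong inj₁ (Fin.toℕ-injective (sym i≡c)))
  inj₁∈block⁺ {k = suc k} (inj₁ i≡c)         = here (cong inj₁ (Fin.toℕ-injective (sym i≡c)))
  inj₁∈block⁺ {k = zero}  (inj₂ (i≡1+c , _)) = there (∈-previous⁺ (sym i≡1+c))

  inj₁∈block⁻ : ∀ {c i k} → inj₁ c ∈ block i k →
                toℕ i ≡ toℕ c ⊎ (toℕ i ≡ suc (toℕ c) × toℕ k ≡ 0)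
  inj₁∈block⁻ {k = zero}  (here refl) = inj₁ refl
  inj₁∈block⁻ {k = zero}  (there p)   = inj₂ (sym (∈-previous⁻ p) , refl)
  inj₁∈block⁻ {k = suc k} (here refl) = inj₁ refl
  inj₁∈block⁻ {k = suc k} (there p) with ∈-map⁻ _ p
  ... | _ , _ , ()

  inj₂∈block⁻ : ∀ {c x i k} → inj₂ (c , x) ∈ block i k →
                i ≡ c × ∃ λ k′ → k ≡ suc k′ × x ∈ bag D k′
  inj₂∈block⁻ {i = zero}  {zero} (there ())
  inj₂∈block⁻ {i = suc i} {zero} (there (here ()))
  inj₂∈block⁻ {k = suc k} (there p) with ∈-map⁻ _ p
  ... | _ , x∈k , refl = refl , k , refl , x∈k

  block-unique : ∀ i k → Unique (block i k)
  block-unique zero    zero    = [] ∷ []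
  block-unique (suc i) zero    = All.¬Any⇒All¬ _ (ℕ.1+n≢n ∘ ∈-previous⁻) ∷ [] ∷ []
  block-unique i       (suc k) =
    All.map⁺ (universal (λ _ ()) (bag D k)) ∷ Unique.map⁺ (,-injectiveʳ ∘ inj₂-injective) (unique D k)

  block-length : ∀ {w} → WidthAtMost D w → ∀ i k → length (block i k) ≤ suc (suc w)
  block-length _   zero    zero    = s≤s z≤n
  block-length _   (suc i) zero    = s≤s (s≤s z≤n)
  block-length D≤w i       (suc k) = s≤s (ℕ.≤-trans (ℕ.≤-reflexive (length-map _ (bag D k))) (D≤w k))

  inj₁∈bags⇒span : ∀ {c} j → inj₁ c ∈ bags j → n * toℕ c ≤ toℕ j × toℕ j ≤ n * suc (toℕ c)
  inj₁∈bags⇒span {c} j c∈j with Fin.combine-surjective {ℓ} {n} j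
  ... | i , k , refl rewrite Fin.toℕ-combine i k =
    quotient⇒between-multiples n (Fin.toℕ<n k) (inj₁∈block⁻ (∈-bags⁻ c∈j))

  span⇒inj₁∈bags : ∀ {c} j → n * toℕ c ≤ toℕ j → toℕ j ≤ n * suc (toℕ c) → inj₁ c ∈ bags j
  span⇒inj₁∈bags {c} j lower upper with Fin.combine-surjective {ℓ} {n} j
  ... | i , k , refl rewrite Fin.toℕ-combine i k =
    ∈-bags⁺ (inj₁∈block⁺ (between-multiples⇒quotient n (Fin.toℕ<n k) lower upper))

  inj₂∈bags⁻ : ∀ {c x} j → inj₂ (c , x) ∈ bags j → ∃ λ k → j ≡ combine c (suc k) × x ∈ bag D k
  inj₂∈bags⁻ j x∈j with Fin.combine-surjective {ℓ} {n} j
  ... | i , k , refl with inj₂∈block⁻ (∈-bags⁻ x∈j)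
  ...   | refl , k′ , refl , x∈k′ = k′ , refl , x∈k′

  bags-interval : ∀ v (j₁ j₂ j₃ : Fin (ℓ * n)) → j₁ Fin.≤ j₂ → j₂ Fin.≤ j₃ →
                  v ∈ bags j₁ → v ∈ bags j₃ → v ∈ bags j₂
  bags-interval (inj₁ c) j₁ j₂ j₃ j₁≤j₂ j₂≤j₃ c∈j₁ c∈j₃ =
    span⇒inj₁∈bags j₂ (ℕ.≤-trans (proj₁ (inj₁∈bags⇒span j₁ c∈j₁)) j₁≤j₂)
                      (ℕ.≤-trans j₂≤j₃ (proj₂ (inj₁∈bags⇒span j₃ c∈j₃)))
  bags-interval (inj₂ (c , x)) j₁ j₂ j₃ j₁≤j₂ j₂≤j₃ x∈j₁ x∈j₃
    with inj₂∈bags⁻ j₁ x∈j₁ | inj₂∈bags⁻ j₃ x∈j₃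
  ... | k₁ , refl , x∈k₁ | k₃ , refl , x∈k₃
    with combine-sandwich {i = c} {k = suc k₁} {l = suc k₃} j₂ j₁≤j₂ j₂≤j₃
  ...   | suc k₂ , refl , s≤s k₁≤k₂ , s≤s k₂≤k₃ =
    ∈-bags⁺ (copy∈block (interval D x k₁ k₂ k₃ k₁≤k₂ k₂≤k₃ x∈k₁ x∈k₃))

  decomposition : PathDecomposition (TVert (suc h) ℓ) (TEdge ℓ (suc h))
  decomposition = record
    { m        = ℓ * n
    ; bag      = bags
    ; unique   = uncurry block-unique ∘ remQuot {ℓ} n
    ; cover    = λ { (inj₁ c) → combine c zero , ∈-bags⁺ (here refl)
                   ; (inj₂ (c , x)) → let k , x∈k = cover D x in
                       combine c (suc k) , ∈-bags⁺ (copy∈block x∈k) }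
    ; edge     = λ { _ _ (path c d 1+c≡d) →
                       combine d zero , ∈-bags⁺ (there (∈-previous⁺ 1+c≡d)) , ∈-bags⁺ (here refl)
                   ; _ _ (hang c x _) → let k , x∈k = cover D x in
                       combine c (suc k) , ∈-bags⁺ (here refl) , ∈-bags⁺ (copy∈block x∈k)
                   ; _ _ (inside c x y e) → let k , x∈k , y∈k = edge D x y e in
                       combine c (suc k) , ∈-bags⁺ (copy∈block x∈k) , ∈-bags⁺ (copy∈block y∈k) }
    ; interval = bags-interval
    }

  decomposition-width : ∀ {w} → WidthAtMost D w → WidthAtMost decomposition (suc w)
  decomposition-width D≤w = uncurry (block-length D≤w) ∘ remQuot {ℓ} n

decomposition-of-width : ∀ {ℓ} h → Σ (PathDecomposition (TVert h ℓ) (TEdge ℓ h)) λ D → WidthAtMost D h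
decomposition-of-width zero    = decomposition₀ , λ _ → s≤s z≤n
decomposition-of-width (suc h) =
  let D , D≤h = decomposition-of-width h in Extension.decomposition D , Extension.decomposition-width D D≤h

data Consecutive : ∀ {n} → Fin n → Fin n → Set where
  step : ∀ {n} (i : Fin n) → Consecutive (inject₁ i) (suc i)

inject₁-consecutive : ∀ {n} → Consecutive {n} =[ inject₁ ]⇒ Consecutive
inject₁-consecutive (step i) = step (inject₁ i)

walk-to-zero : ∀ {n} (i : Fin (suc n)) → Walk Consecutive i zero
walk-to-zero zero            = ε
walk-to-zero {suc n} (suc i) = bwd (step i) ◅ mapWalk inject₁ inject₁-consecutive (walk-to-zero i)

root : ∀ {ℓ} h → TVert h (suc ℓ)
root zero    = tt
root (suc h) = inj₁ zero

root-isRoot : ∀ {ℓ} h → IsRoot h (suc ℓ) (root h)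
root-isRoot zero    = tt
root-isRoot (suc h) = refl

consecutive⇒path : ∀ {ℓ h} → Consecutive =[ inj₁ ]⇒ TEdge ℓ (suc h)
consecutive⇒path (step i) = path (inject₁ i) (suc i) (cong suc (Fin.toℕ-inject₁ i))

module _ {ℓ h} (P : TVert (suc h) (suc ℓ) → Set) (P-path : ∀ i → P (inj₁ i))
         (a : Fin (suc ℓ)) (P-copy : ∀ x → P (inj₂ (a , x))) where

  path-vertex : Fin (suc ℓ) → Σ (TVert (suc h) (suc ℓ)) P
  path-vertex i = inj₁ i , P-path i

  copy-vertex : TVert h (suc ℓ) → Σ (TVert (suc h) (suc ℓ)) P
  copy-vertex x = inj₂ (a , x) , P-copy x

  copy-walk-to-root : ∀ {x} → Walk (TEdge (suc ℓ) h) x (root h) →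
                      Walk (TEdge (suc ℓ) (suc h) on proj₁) (copy-vertex x) (path-vertex zero)
  copy-walk-to-root within-copy =
    mapWalk copy-vertex (inside a _ _) within-copy
    ◅◅ bwd (hang a (root h) (root-isRoot h))
    ◅ mapWalk path-vertex consecutive⇒path (walk-to-zero a)

walk-to-root : ∀ {ℓ} h (x : TVert h (suc ℓ)) → Walk (TEdge (suc ℓ) h) x (root h)
walk-to-root zero    tt            = ε
walk-to-root (suc h) (inj₁ i)      = mapWalk inj₁ consecutive⇒path (walk-to-zero i)
walk-to-root (suc h) (inj₂ (a , x)) =
  mapWalk proj₁ (λ e → e) (copy-walk-to-root (λ _ → ⊤) _ a _ (walk-to-root h x))

OutsideCopy : ∀ {ℓ h} → Fin ℓ → TVert (suc h) ℓ → Set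
OutsideCopy c (inj₁ _)       = ⊤
OutsideCopy c (inj₂ (d , _)) = d ≢ c

walk-avoiding-copy : ∀ {ℓ h} {a b c : Fin (suc ℓ)} (a≢c : a ≢ c) (b≢c : b ≢ c)
                     (x y : TVert h (suc ℓ)) →
                     Walk (TEdge (suc ℓ) (suc h) on proj₁) (inj₂ (a , x) , a≢c) (inj₂ (b , y) , b≢c)
walk-avoiding-copy {h = h} {a} {b} {c} a≢c b≢c x y =
  copy-walk-to-root (OutsideCopy c) _ a (λ _ → a≢c) (walk-to-root h x)
  ◅◅ reverseWalk (copy-walk-to-root (OutsideCopy c) _ b (λ _ → b≢c) (walk-to-root h y))

copyModel : ∀ {ℓ h m} → Fin ℓ → IntervalModel (TVert (suc h) ℓ) (TEdge ℓ (suc h)) m →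
            IntervalModel (TVert h ℓ) (TEdge ℓ h) m
copyModel a = comap (λ x → inj₂ (a , x)) (inside a _ _)

module _ {ℓ h m} (M : IntervalModel (TVert (suc h) (suc ℓ)) (TEdge (suc ℓ) (suc h)) m) where

  outside-copy-between : ∀ {a b c x y i j k} → a ≢ c → b ≢ c →
                         interval M (inj₂ (a , x)) i → interval M (inj₂ (b , y)) k →
                         i Fin.≤ j → j Fin.≤ k →
                         ∃ λ z → OutsideCopy c z × interval M z j
  outside-copy-between {x = x} {y} a≢c b≢c x∈i y∈k i≤j j≤k
    with walk-meets-between (comap proj₁ (λ e → e) M) (walk-avoiding-copy a≢c b≢c x y) x∈i y∈k i≤j j≤k
  ... | (z , z-outside) , z∈j = z , z-outside , z∈j

  extend-stab : ∀ {c n} (s : Stab (copyModel c M) n) (z : TVert (suc h) (suc ℓ)) → OutsideCopy c z →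
                interval M z (Stab.point s) → Stab M (suc n)
  extend-stab {c} {n} s z z-outside z∈point = record
    { point            = point
    ; vertex           = vertex′
    ; vertex-injective = vertex′-injective
    ; point∈interval   = λ { zero → z∈point ; (suc t) → point∈interval t }
    }
    where
    open Stab s
    vertex′ : Fin (suc n) → TVert (suc h) (suc ℓ)
    vertex′ zero    = z
    vertex′ (suc t) = inj₂ (c , vertex t)
    vertex′-injective : Injective _≡_ _≡_ vertex′
    vertex′-injective {zero}  {zero}  _  = refl
    vertex′-injective {zero}  {suc t} eq = contradiction refl (subst (OutsideCopy c) eq z-outside)
    vertex′-injective {suc t} {zero}  eq = contradiction refl (subst (OutsideCopy c) (sym eq) z-outside)
    vertex′-injective {suc t} {suc u} eq = cong suc (vertex-injective (,-injectiveʳ (inj₂-injective eq)))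

stab-step : ∀ {ℓ h m} (M : IntervalModel (TVert (suc h) (3 + ℓ)) (TEdge (3 + ℓ) (suc h)) m) →
            (∀ c → Stab (copyModel c M) (suc h)) → Stab M (suc (suc h))
stab-step {ℓ} M stab-copy with median-of-three (Stab.point ∘ stab-copy ∘ (_↑ˡ ℓ))
... | a , b , c , a≢c , b≢c , a≤c , c≤b
  with outside-copy-between M (a≢c ∘ Fin.↑ˡ-injective ℓ a c) (b≢c ∘ Fin.↑ˡ-injective ℓ b c)
         (Stab.point∈interval (stab-copy (a ↑ˡ ℓ)) zero)
         (Stab.point∈interval (stab-copy (b ↑ˡ ℓ)) zero) a≤c c≤b
... | z , z-outside , z∈point = extend-stab M (stab-copy (c ↑ˡ ℓ)) z z-outside z∈point

stab : ∀ {ℓ m} h (M : IntervalModel (TVert h (3 + ℓ)) (TEdge (3 + ℓ) h) m) → Stab M (suc h)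
stab zero M = record
  { point            = proj₁ (inhabited M tt)
  ; vertex           = λ _ → tt
  ; vertex-injective = λ { {zero} {zero} _ → refl }
  ; point∈interval   = λ { zero → proj₂ (inhabited M tt) }
  }
stab (suc h) M = stab-step M (λ c → stab h (copyModel c M))

lemma2 : (k ℓ : ℕ) → 1 ≤ k → 4 ≤ ℓ → k * k ≤ ℓ →
    (h : ℕ) → PathwidthIs (TVert h ℓ) (TEdge ℓ h) h
lemma2 _ _ _ (s≤s (s≤s (s≤s _))) _ h =
  decomposition-of-width h , λ D → stab⇒width D (stab h (intervalModel D))
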